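{- For all integers $a,b$, in $\tilde{\mathrm{CH}}_2$: \[ \tilde h_a\tilde h_b-\tilde h_{a-1}\tilde h_{b-1}=\tilde h_{a+b},\qquad \tilde h_a\tilde h_b-\tilde h_{a-2}\tilde h_b=\tilde h_{b+a}+\tilde h_{b-a}. \]
   Context: $\tau(i)=|i+1|-1$. $\tilde{\mathrm{CH}}_2$: the ring generated by $\tilde h_i$, $i\in\mathbb{Z}$; its elements are finite integer linear combinations of the linearly independent symbols $\tilde h_i$, with bilinear multiplication $\tilde h_{ -1}\tilde h_j=0$, $\tilde h_i\tilde h_j=\sum_{k=0}^i\tilde h_{j-i+2k}$ for $i\ge0$, and $\tilde h_i\tilde h_j=-\tilde h_{\tau(i)}\tilde h_j$ for $i<-1$. -}

module Defs where

open import Data.Integer using (ℤ; +_; -[1+_]; _+_; _-_; _*_; -_; ∣_∣; 0ℤ; 1ℤ)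
open import Data.Integer.Properties using (_≟_)
open import Data.Nat using (ℕ; zero; suc)
open import Data.List using (List; []; _∷_; _++_; map; concatMap)
open import Data.Product using (_×_; _,_)
open import Data.Bool using (if_then_else_)
open import Relation.Nullary using (does)

-- An element of CH̃₂: a finite formal ℤ-linear combination of the symbols h̃ᵢ (i ∈ ℤ),
-- represented as a list of (coefficient , index) pairs.
CH : Set
CH = List (ℤ × ℤ)

coeff : CH → ℤ → ℤ
coeff [] n = 0ℤ
coeff ((c , i) ∷ xs) n = (if does (i ≟ n) then c else 0ℤ) + coeff xs n

infix 4 _≈_
_≈_ : CH → CH → Set
x ≈ y = ∀ n → coeff x n ≡′ coeff y n
  where open import Relation.Binary.PropositionalEquality renaming (_≡_ to _≡′_)

h : ℤ → CH
h i = (1ℤ , i) ∷ []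

zeroCH : CH
zeroCH = []

infixl 6 _⊕_ _⊖_
_⊕_ : CH → CH → CH
x ⊕ y = x ++ y

neg : CH → CH
neg = map (λ { (c , i) → (- c , i) })

_⊖_ : CH → CH → CH
x ⊖ y = x ⊕ neg y

scale : ℤ → CH → CH
scale a = map (λ { (c , i) → (a * c , i) })

τ : ℤ → ℤ
τ i = + ∣ i + 1ℤ ∣ - 1ℤ

sumTerms : ℕ → ℤ → CH
sumTerms n j = go n
  where
  go : ℕ → CH
  go zero = h (j - + n)
  go (suc k) = go k ⊕ h (j - + n + + 2 * + suc k)

mulBasis : ℤ → ℤ → CH
mulBasis (+ n) j = sumTerms n j
mulBasis -[1+ zero ] j = zeroCH
mulBasis -[1+ suc m ] j = neg (mulBasis (τ -[1+ suc m ]) j)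

infixl 7 _⊗_
_⊗_ : CH → CH → CH
x ⊗ y = concatMap (λ { (a , i) → concatMap (λ { (b , j) → scale (a * b) (mulBasis i j) }) y }) x

-- Write Lₜ for the formal series h̃ₜ + h̃ₜ₋₂ + h̃ₜ₋₄ + ⋯, so that h̃ₜ = Lₜ − Lₜ₋₂. For i ≥ 0 the
-- defining sum of h̃ᵢh̃ⱼ telescopes to L_{j+i} − L_{j−i−2}; this formula also holds for i = −1,
-- where the two series coincide, and for i < −1, because it changes sign under i ↦ −2 − i = τ i.
-- Each identity then rearranges the resulting four series into Lₛ − Lₛ₋₂ (+ Lₛ′ − Lₛ′₋₂).
module Submission where

open import Defs
open import Data.Integer using (ℤ; +_; -[1+_]; 0ℤ; 1ℤ; _+_; _-_; -_; _*_)
open import Data.Integer.Properties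
  using (_≟_; +-identityʳ; +-identityˡ; +-assoc; +-comm; +-inverseʳ; neg-distrib-+; *-zeroʳ;
         *-identityˡ; *-distribˡ-+; +-minus-telescope; i≡j⇒i-j≡0; i-j≡0⇒i≡j; +-0-abelianGroup)
open import Algebra.Properties.AbelianGroup +-0-abelianGroup using (⁻¹-anti-homo‿-)
open import Data.Integer.Tactic.RingSolver using (solve; solve-∀)
open import Data.Nat using (ℕ; zero; suc)
open import Data.Product using (_×_; _,_)
open import Data.List using ([]; _∷_; _++_)
open import Data.List.Properties using (++-identityʳ)
open import Data.Bool using (true; false; if_then_else_)
open import Data.Bool.Properties using (if-float)
open import Function.Bundles using (mk⇔)
open import Relation.Nullary using (does)
open import Relation.Nullary.Decidable using (does-⇔)
open import Relation.Binary.PropositionalEquality using (_≡_; refl; sym; trans; cong; cong₂)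
open Relation.Binary.PropositionalEquality.≡-Reasoning

coeff-⊕ : ∀ x y n → coeff (x ⊕ y) n ≡ coeff x n + coeff y n
coeff-⊕ [] y n = sym (+-identityˡ (coeff y n))
coeff-⊕ ((c , i) ∷ x) y n = trans (cong (_+_ d) (coeff-⊕ x y n)) (sym (+-assoc d (coeff x n) (coeff y n)))
  where d = if does (i ≟ n) then c else 0ℤ

coeff-neg : ∀ x n → coeff (neg x) n ≡ - coeff x n
coeff-neg [] n = refl
coeff-neg ((c , i) ∷ x) n = trans (cong₂ _+_ (sym (if-float -_ (does (i ≟ n)))) (coeff-neg x n))
  (sym (neg-distrib-+ d (coeff x n)))
  where d = if does (i ≟ n) then c else 0ℤ

coeff-⊖ : ∀ x y n → coeff (x ⊖ y) n ≡ coeff x n - coeff y n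
coeff-⊖ x y n = trans (coeff-⊕ x (neg y) n) (cong (_+_ (coeff x n)) (coeff-neg y n))

*-distrib-if-0ℤ : ∀ a b c → a * (if b then c else 0ℤ) ≡ (if b then a * c else 0ℤ)
*-distrib-if-0ℤ a true c = refl
*-distrib-if-0ℤ a false c = *-zeroʳ a

coeff-scale : ∀ a x n → coeff (scale a x) n ≡ a * coeff x n
coeff-scale a [] n = sym (*-zeroʳ a)
coeff-scale a ((c , i) ∷ x) n = trans (cong₂ _+_ (sym (*-distrib-if-0ℤ a (does (i ≟ n)) c)) (coeff-scale a x n))
  (sym (*-distribˡ-+ a d (coeff x n)))
  where d = if does (i ≟ n) then c else 0ℤ

h⊗h≈mulBasis : ∀ i j → h i ⊗ h j ≈ mulBasis i j
h⊗h≈mulBasis i j n = begin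
  coeff ((scale 1ℤ (mulBasis i j) ++ []) ++ []) n
    ≡⟨ cong (λ x → coeff x n) (trans (++-identityʳ (scale 1ℤ (mulBasis i j) ++ [])) (++-identityʳ _)) ⟩
  coeff (scale 1ℤ (mulBasis i j)) n  ≡⟨ coeff-scale 1ℤ (mulBasis i j) n ⟩
  1ℤ * coeff (mulBasis i j) n        ≡⟨ *-identityˡ (coeff (mulBasis i j) n) ⟩
  coeff (mulBasis i j) n             ∎

evenNatIndicator : ℤ → ℤ
evenNatIndicator (+ zero) = 1ℤ
evenNatIndicator (+ suc zero) = 0ℤ
evenNatIndicator (+ suc (suc n)) = evenNatIndicator (+ n)
evenNatIndicator -[1+ n ] = 0ℤ

evenNatIndicator-step : ∀ d → evenNatIndicator d - evenNatIndicator (d - + 2) ≡ (if does (d ≟ 0ℤ) then 1ℤ else 0ℤ)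
evenNatIndicator-step (+ zero) = refl
evenNatIndicator-step (+ suc zero) = refl
evenNatIndicator-step (+ suc (suc n)) = +-inverseʳ (evenNatIndicator (+ n))
evenNatIndicator-step -[1+ n ] = refl

-- ladder t m is the coefficient of h̃ₘ in the series Lₜ = h̃ₜ + h̃ₜ₋₂ + h̃ₜ₋₄ + ⋯. It is opaque:
-- everything below uses only coeff-h, and opacity lets unification read the index off ladder t m.
opaque
  ladder : ℤ → ℤ → ℤ
  ladder t m = evenNatIndicator (t - m)

  coeff-h : ∀ t m → coeff (h t) m ≡ ladder t m - ladder (t - + 2) m
  coeff-h t m = begin
    (if does (t ≟ m) then 1ℤ else 0ℤ) + 0ℤ
      ≡⟨ +-identityʳ _ ⟩
    (if does (t ≟ m) then 1ℤ else 0ℤ)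
      ≡⟨ cong (if_then 1ℤ else 0ℤ) (does-⇔ (mk⇔ i≡j⇒i-j≡0 (i-j≡0⇒i≡j t m)) (t ≟ m) (t - m ≟ 0ℤ)) ⟩
    (if does (t - m ≟ 0ℤ) then 1ℤ else 0ℤ)
      ≡⟨ evenNatIndicator-step (t - m) ⟨
    evenNatIndicator (t - m) - evenNatIndicator (t - m - + 2)
      ≡⟨ cong (λ d → evenNatIndicator (t - m) - evenNatIndicator d) {t - m - + 2} {t - + 2 - m} (solve (t ∷ m ∷ [])) ⟩
    evenNatIndicator (t - m) - evenNatIndicator (t - + 2 - m) ∎

-- The local function go of sumTerms cannot be referred to by name. sumTermsGo is a metavariable,
-- and the with-abstracted refl in sumTerms-suc forces its solution to be go itself.
mutual
  sumTermsGo : ℕ → ℤ → ℕ → CH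
  sumTermsGo = _

  sumTerms-suc : ∀ n j → sumTerms (suc n) j ≡ sumTermsGo (suc n) j n ⊕ h (j - + suc n + + 2 * + suc n)
  sumTerms-suc n j with n | suc n
  ... | k | w = refl

coeff-sumTermsGo : ∀ n j k m →
  coeff (sumTermsGo n j k) m ≡ ladder (j - + n + + 2 * + k) m - ladder (j - + n - + 2) m
coeff-sumTermsGo n j zero m = trans (coeff-h (j - + n) m)
  (cong (λ t → ladder t m - ladder (j - + n - + 2) m) (sym (+-identityʳ (j - + n))))
coeff-sumTermsGo n j (suc k) m = begin
  coeff (sumTermsGo n j k ⊕ h t′) m              ≡⟨ coeff-⊕ (sumTermsGo n j k) (h t′) m ⟩
  coeff (sumTermsGo n j k) m + coeff (h t′) m    ≡⟨ cong₂ _+_ (coeff-sumTermsGo n j k m) (coeff-h t′ m) ⟩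
  (ladder t m - ladder s m) + (ladder t′ m - ladder (t′ - + 2) m)
    ≡⟨ cong (λ r → (ladder t m - ladder s m) + (ladder t′ m - ladder r m)) (two-steps-back L (+ k)) ⟩
  (ladder t m - ladder s m) + (ladder t′ m - ladder t m)
    ≡⟨ +-comm (ladder t m - ladder s m) (ladder t′ m - ladder t m) ⟩
  (ladder t′ m - ladder t m) + (ladder t m - ladder s m)
    ≡⟨ +-minus-telescope (ladder t′ m) (ladder t m) (ladder s m) ⟩
  ladder t′ m - ladder s m ∎
  where
  L = j - + n
  s = L - + 2
  t = L + + 2 * + k
  t′ = L + + 2 * + suc k
  two-steps-back : ∀ u x → u + + 2 * (1ℤ + x) - + 2 ≡ u + + 2 * x
  two-steps-back = solve-∀

coeff-sumTerms : ∀ n j m → coeff (sumTerms n j) m ≡ ladder (j + + n) m - ladder (j - + n - + 2) m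
coeff-sumTerms n j m = trans (coeff-sumTermsGo n j n m)
  (cong (λ t → ladder t m - ladder (j - + n - + 2) m) (last-index j (+ n)))
  where
  last-index : ∀ j x → j - x + + 2 * x ≡ j + x
  last-index = solve-∀

productCoeff : ℤ → ℤ → ℤ → ℤ
productCoeff i j m = ladder (j + i) m - ladder (j - i - + 2) m

productCoeff-reflect : ∀ i j m → productCoeff (- (+ 2 + i)) j m ≡ - productCoeff i j m
productCoeff-reflect i j m = begin
  ladder (j + - (+ 2 + i)) m - ladder (j - - (+ 2 + i) - + 2) m
    ≡⟨ cong₂ (λ s t → ladder s m - ladder t m) (solve (i ∷ j ∷ [])) (solve (i ∷ j ∷ [])) ⟩
  ladder (j - i - + 2) m - ladder (j + i) m
    ≡⟨ ⁻¹-anti-homo‿- (ladder (j + i) m) (ladder (j - i - + 2) m) ⟨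
  - productCoeff i j m ∎

-- For k : ℕ, -[1+ suc k ] is definitionally - (+ 2 + + k), and τ of it computes to + k.
coeff-mulBasis : ∀ i j m → coeff (mulBasis i j) m ≡ productCoeff i j m
coeff-mulBasis (+ n) j m = coeff-sumTerms n j m
coeff-mulBasis -[1+ zero ] j m = begin
  0ℤ                                                   ≡⟨ +-inverseʳ (ladder (j + -[1+ zero ]) m) ⟨
  ladder (j + -[1+ zero ]) m - ladder (j + -[1+ zero ]) m
    ≡⟨ cong (λ t → ladder (j + -[1+ zero ]) m - ladder t m) (solve (j ∷ [])) ⟩
  productCoeff -[1+ zero ] j m ∎
coeff-mulBasis -[1+ suc k ] j m = begin
  coeff (neg (mulBasis (+ k) j)) m  ≡⟨ coeff-neg (mulBasis (+ k) j) m ⟩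
  - coeff (mulBasis (+ k) j) m      ≡⟨ cong -_ (coeff-mulBasis (+ k) j m) ⟩
  - productCoeff (+ k) j m          ≡⟨ productCoeff-reflect (+ k) j m ⟨
  productCoeff -[1+ suc k ] j m     ∎

coeff-h⊗h⊖h⊗h : ∀ a b c d m → coeff (h a ⊗ h b ⊖ h c ⊗ h d) m ≡ productCoeff a b m - productCoeff c d m
coeff-h⊗h⊖h⊗h a b c d m = begin
  coeff (h a ⊗ h b ⊖ h c ⊗ h d) m
    ≡⟨ coeff-⊖ (h a ⊗ h b) (h c ⊗ h d) m ⟩
  coeff (h a ⊗ h b) m - coeff (h c ⊗ h d) m
    ≡⟨ cong₂ _-_ (h⊗h≈mulBasis a b m) (h⊗h≈mulBasis c d m) ⟩
  coeff (mulBasis a b) m - coeff (mulBasis c d) m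
    ≡⟨ cong₂ _-_ (coeff-mulBasis a b m) (coeff-mulBasis c d m) ⟩
  productCoeff a b m - productCoeff c d m ∎

[x-z]-[y-z]≡x-y : ∀ x y z → (x - z) - (y - z) ≡ x - y
[x-z]-[y-z]≡x-y = solve-∀

[w-x]-[y-z]≡[w-y]+[z-x] : ∀ w x y z → (w - x) - (y - z) ≡ (w - y) + (z - x)
[w-x]-[y-z]≡[w-y]+[z-x] = solve-∀

h⊗h⊖h⊗h-diagonal : ∀ a b → h a ⊗ h b ⊖ h (a - 1ℤ) ⊗ h (b - 1ℤ) ≈ h (a + b)
h⊗h⊖h⊗h-diagonal a b m = begin
  coeff (h a ⊗ h b ⊖ h (a - 1ℤ) ⊗ h (b - 1ℤ)) m
    ≡⟨ coeff-h⊗h⊖h⊗h a b (a - 1ℤ) (b - 1ℤ) m ⟩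
  productCoeff a b m - productCoeff (a - 1ℤ) (b - 1ℤ) m
    ≡⟨ cong₂ (λ s t → productCoeff a b m - (ladder s m - ladder t m)) (solve (a ∷ b ∷ [])) (solve (a ∷ b ∷ [])) ⟩
  (ladder (b + a) m - ladder (b - a - + 2) m) - (ladder (b + a - + 2) m - ladder (b - a - + 2) m)
    ≡⟨ [x-z]-[y-z]≡x-y (ladder (b + a) m) (ladder (b + a - + 2) m) (ladder (b - a - + 2) m) ⟩
  ladder (b + a) m - ladder (b + a - + 2) m
    ≡⟨ coeff-h (b + a) m ⟨
  coeff (h (b + a)) m
    ≡⟨ cong (λ t → coeff (h t) m) (+-comm b a) ⟩
  coeff (h (a + b)) m ∎

h⊗h⊖h⊗h-left : ∀ a b → h a ⊗ h b ⊖ h (a - + 2) ⊗ h b ≈ h (b + a) ⊕ h (b - a)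
h⊗h⊖h⊗h-left a b m = begin
  coeff (h a ⊗ h b ⊖ h (a - + 2) ⊗ h b) m
    ≡⟨ coeff-h⊗h⊖h⊗h a b (a - + 2) b m ⟩
  productCoeff a b m - productCoeff (a - + 2) b m
    ≡⟨ cong₂ (λ s t → productCoeff a b m - (ladder s m - ladder t m)) (solve (a ∷ b ∷ [])) (solve (a ∷ b ∷ [])) ⟩
  (ladder (b + a) m - ladder (b - a - + 2) m) - (ladder (b + a - + 2) m - ladder (b - a) m)
    ≡⟨ [w-x]-[y-z]≡[w-y]+[z-x] (ladder (b + a) m) (ladder (b - a - + 2) m) (ladder (b + a - + 2) m) (ladder (b - a) m) ⟩
  (ladder (b + a) m - ladder (b + a - + 2) m) + (ladder (b - a) m - ladder (b - a - + 2) m)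
    ≡⟨ cong₂ _+_ (coeff-h (b + a) m) (coeff-h (b - a) m) ⟨
  coeff (h (b + a)) m + coeff (h (b - a)) m
    ≡⟨ coeff-⊕ (h (b + a)) (h (b - a)) m ⟨
  coeff (h (b + a) ⊕ h (b - a)) m ∎

lemma3p9 : (a b : ℤ) →
    ((h a ⊗ h b) ⊖ (h (a - 1ℤ) ⊗ h (b - 1ℤ)) ≈ h (a + b))
    × ((h a ⊗ h b) ⊖ (h (a - + 2) ⊗ h b) ≈ (h (b + a) ⊕ h (b - a)))
lemma3p9 a b = h⊗h⊖h⊗h-diagonal a b , h⊗h⊖h⊗h-left a b
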